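{- Suppose Straight Descent is started at a uniformly random Boolean $n$-tuple, conditioned on it having $m_0$ ones, and after step $t$, where $t\le n-m_0$, the current tuple has $m$ ones. Then, conditionally, this tuple is uniformly distributed among all Boolean $n$-tuples with $m$ ones.
   Context: Straight Descent (SD) on $n$ Boolean variables (the target solution being the all-ones tuple): while some variable is assigned 0, pick a variable $x_j$ uniformly at random from all $n$ variables, and if its current value is 0, set it to 1. Each such iteration is one step. The process does not depend on any formula. -}

module Defs where

open import Data.Nat using (ℕ; zero; suc; _+_)
open import Data.Bool using (Bool; true; false; if_then_else_; _∧_)
open import Data.Fin using (Fin)
open import Data.Fin.Base using () renaming (zero to fzero; suc to fsuc)
open import Data.Vec using (Vec; []; _∷_; _[_]≔_)
open import Data.List using (List; []; _∷_; map; concatMap; _++_)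
open import Data.Product using (_×_; _,_)
open import Data.Nat using (_≡ᵇ_)

ones : ∀ {n} → Vec Bool n → ℕ
ones [] = 0
ones (true ∷ xs) = suc (ones xs)
ones (false ∷ xs) = ones xs

allOnes : ∀ {n} → Vec Bool n → Bool
allOnes [] = true
allOnes (b ∷ xs) = b ∧ allOnes xs

eqBool : Bool → Bool → Bool
eqBool true true = true
eqBool false false = true
eqBool _ _ = false

eqVec : ∀ {n} → Vec Bool n → Vec Bool n → Bool
eqVec [] [] = true
eqVec (a ∷ xs) (b ∷ ys) = eqBool a b ∧ eqVec xs ys

sdStep : ∀ {n} → Vec Bool n → Fin n → Vec Bool n
sdStep x j = x [ j ]≔ true

sdRun : ∀ {n t} → Vec Bool n → Vec (Fin n) t → Vec Bool n
sdRun x [] = x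
sdRun x (j ∷ js) = if allOnes x then x else sdRun (sdStep x j) js

allFins : ∀ n → List (Fin n)
allFins zero = []
allFins (suc n) = fzero ∷ map fsuc (allFins n)

allBoolVecs : ∀ n → List (Vec Bool n)
allBoolVecs zero = [] ∷ []
allBoolVecs (suc n) = map (true ∷_) (allBoolVecs n) ++ map (false ∷_) (allBoolVecs n)

allSeqs : ∀ n t → List (Vec (Fin n) t)
allSeqs n zero = [] ∷ []
allSeqs n (suc t) = concatMap (λ j → map (j ∷_) (allSeqs n t)) (allFins n)

-- Sample space: starting tuple x (uniform over all Boolean n-tuples)
-- together with t independent uniform choices in Fin n; all outcomes
-- are equally likely.
outcomes : ∀ n t → List (Vec Bool n × Vec (Fin n) t)
outcomes n t = concatMap (λ x → map (x ,_) (allSeqs n t)) (allBoolVecs n)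

countL : ∀ {A : Set} → (A → Bool) → List A → ℕ
countL p [] = 0
countL p (a ∷ as) = if p a then suc (countL p as) else countL p as

-- Number of (equally likely) outcomes in which the start has m0 ones
-- and the tuple after step t equals y.  Proportional to the probability
-- P(start has m0 ones and tuple after step t is y).
weightTo : ∀ n m0 t → Vec Bool n → ℕ
weightTo n m0 t y =
  countL (λ { (x , js) → (ones x ≡ᵇ m0) ∧ eqVec (sdRun x js) y }) (outcomes n t)

-- Straight Descent commutes with renaming the variables: transposing two
-- coordinates of the start tuple and of every chosen index transposes the
-- final tuple in the same way.  The uniform start, the uniform choices and
-- the number of ones of the start are all invariant under the renaming, so
-- the weight of ending at y is invariant under transposing coordinates of y.
-- Adjacent transpositions already connect any two tuples with the same
-- number of ones.
module Submission where

open import Defs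
open import Data.Nat using (ℕ; _≤_; _∸_; zero; suc; _+_; z≤n; s≤s; _≡ᵇ_)
open import Data.Nat.Properties using (+-commutativeSemigroup; m≤n⇒m≤1+n)
open import Data.Nat.ListAction using (sum)
open import Data.Nat.ListAction.Properties using (sum-++)
open import Data.Bool using (Bool; true; false; _∧_)
open import Data.Bool.Properties using (∧-commutativeMonoid)
open import Data.Vec using (Vec; []; _∷_; _[_]≔_)
import Data.Vec as Vec
open import Data.List using (List; []; _∷_; map; concatMap; _++_)
open import Data.List.Properties using (map-++; map-∘; map-cong)
open import Data.Fin using (Fin) renaming (zero to fzero; suc to fsuc)
open import Data.Product using (_×_; _,_)
import Data.Product as Product
open import Function using (_∘_)
open import Algebra.Bundles using (CommutativeMonoid)
open import Relation.Binary.PropositionalEquality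
open ≡-Reasoning

open import Algebra.Properties.CommutativeSemigroup +-commutativeSemigroup
  using (interchange) renaming (x∙yz≈y∙xz to +-exchange)
open import Algebra.Properties.CommutativeSemigroup
  (CommutativeMonoid.commutativeSemigroup ∧-commutativeMonoid)
  using () renaming (x∙yz≈y∙xz to ∧-exchange)

private
  variable
    A B C : Set
    n t : ℕ

sum-map-∘ : (f : B → ℕ) (g : A → B) (xs : List A) →
            sum (map f (map g xs)) ≡ sum (map (f ∘ g) xs)
sum-map-∘ f g xs = cong sum (sym (map-∘ xs))

sum-map-cong : {f g : A → ℕ} → (∀ a → f a ≡ g a) → (xs : List A) →
               sum (map f xs) ≡ sum (map g xs)
sum-map-cong f≗g xs = cong sum (map-cong f≗g xs)

countL-cong : {p q : A → Bool} → (∀ a → p a ≡ q a) → (xs : List A) →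
              countL p xs ≡ countL q xs
countL-cong p≗q []       = refl
countL-cong p≗q (a ∷ xs) rewrite p≗q a | countL-cong p≗q xs = refl

countL-map : (p : B → Bool) (g : A → B) (xs : List A) →
             countL p (map g xs) ≡ countL (p ∘ g) xs
countL-map p g []       = refl
countL-map p g (a ∷ xs) with p (g a)
... | true  = cong suc (countL-map p g xs)
... | false = countL-map p g xs

countL-++ : (p : A → Bool) (xs ys : List A) →
            countL p (xs ++ ys) ≡ countL p xs + countL p ys
countL-++ p []       ys = refl
countL-++ p (a ∷ xs) ys with p a
... | true  = cong suc (countL-++ p xs ys)
... | false = countL-++ p xs ys

countL-concatMap : (p : B → Bool) (f : A → List B) (xs : List A) →
                   countL p (concatMap f xs) ≡ sum (map (countL p ∘ f) xs)
countL-concatMap p f []       = refl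
countL-concatMap p f (a ∷ xs) =
  trans (countL-++ p (f a) (concatMap f xs))
        (cong (countL p (f a) +_) (countL-concatMap p f xs))

countL-concatMap-map : (p : C → Bool) (g : A → B → C) (ys : List B) (xs : List A) →
                       countL p (concatMap (λ a → map (g a) ys) xs)
                       ≡ sum (map (λ a → countL (p ∘ g a) ys) xs)
countL-concatMap-map p g ys xs =
  trans (countL-concatMap p _ xs) (sum-map-cong (λ a → countL-map p (g a) ys) xs)

-- The transposition of two adjacent positions among n.
data Swap : ℕ → Set where
  here  : Swap (suc (suc n))
  there : Swap n → Swap (suc n)

swapFin : Swap n → Fin n → Fin n
swapFin here      fzero               = fsuc fzero
swapFin here      (fsuc fzero)        = fzero
swapFin here      (fsuc (fsuc i))     = fsuc (fsuc i)
swapFin (there s) fzero               = fzero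
swapFin (there s) (fsuc i)            = fsuc (swapFin s i)

swapVec : Swap n → Vec A n → Vec A n
swapVec here      (a ∷ b ∷ v) = b ∷ a ∷ v
swapVec (there s) (a ∷ v)     = a ∷ swapVec s v

swapVec-[]≔ : (s : Swap n) (v : Vec A n) (i : Fin n) (a : A) →
              swapVec s (v [ i ]≔ a) ≡ swapVec s v [ swapFin s i ]≔ a
swapVec-[]≔ here      (b ∷ c ∷ v) fzero           a = refl
swapVec-[]≔ here      (b ∷ c ∷ v) (fsuc fzero)    a = refl
swapVec-[]≔ here      (b ∷ c ∷ v) (fsuc (fsuc i)) a = refl
swapVec-[]≔ (there s) (b ∷ v)     fzero           a = refl
swapVec-[]≔ (there s) (b ∷ v)     (fsuc i)        a = cong (b ∷_) (swapVec-[]≔ s v i a)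

allOnes-swapVec : (s : Swap n) (x : Vec Bool n) → allOnes (swapVec s x) ≡ allOnes x
allOnes-swapVec here      (a ∷ b ∷ x) = ∧-exchange b a (allOnes x)
allOnes-swapVec (there s) (a ∷ x)     = cong (a ∧_) (allOnes-swapVec s x)

ones-swapVec : (s : Swap n) (x : Vec Bool n) → ones (swapVec s x) ≡ ones x
ones-swapVec here      (true  ∷ true  ∷ x) = refl
ones-swapVec here      (true  ∷ false ∷ x) = refl
ones-swapVec here      (false ∷ true  ∷ x) = refl
ones-swapVec here      (false ∷ false ∷ x) = refl
ones-swapVec (there s) (true  ∷ x)         = cong suc (ones-swapVec s x)
ones-swapVec (there s) (false ∷ x)         = ones-swapVec s x

eqVec-swapVec : (s : Swap n) (x y : Vec Bool n) →
                eqVec (swapVec s x) (swapVec s y) ≡ eqVec x y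
eqVec-swapVec here      (a ∷ b ∷ x) (c ∷ d ∷ y) = ∧-exchange (eqBool b d) (eqBool a c) (eqVec x y)
eqVec-swapVec (there s) (a ∷ x)     (c ∷ y)     = cong (eqBool a c ∧_) (eqVec-swapVec s x y)

sdRun-swap : (s : Swap n) (x : Vec Bool n) (js : Vec (Fin n) t) →
             sdRun (swapVec s x) (Vec.map (swapFin s) js) ≡ swapVec s (sdRun x js)
sdRun-swap s x []       = refl
sdRun-swap s x (j ∷ js) rewrite allOnes-swapVec s x with allOnes x
... | true  = refl
... | false = begin
  sdRun (swapVec s x [ swapFin s j ]≔ true) (Vec.map (swapFin s) js)
    ≡⟨ cong (λ z → sdRun z (Vec.map (swapFin s) js)) (sym (swapVec-[]≔ s x j true)) ⟩
  sdRun (swapVec s (sdStep x j)) (Vec.map (swapFin s) js)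
    ≡⟨ sdRun-swap s (sdStep x j) js ⟩
  swapVec s (sdRun (sdStep x j) js) ∎

sum-allFins-suc : (G : Fin (suc n) → ℕ) →
                  sum (map G (allFins (suc n))) ≡ G fzero + sum (map (G ∘ fsuc) (allFins n))
sum-allFins-suc {n} G = cong (G fzero +_) (sum-map-∘ G fsuc (allFins n))

sum-allFins-swap : (s : Swap n) (G : Fin n → ℕ) →
                   sum (map G (allFins n)) ≡ sum (map (G ∘ swapFin s) (allFins n))
sum-allFins-swap here G = begin
  sum (map G (allFins _))                             ≡⟨ sum-allFins-suc² G ⟩
  G fzero + (G (fsuc fzero) + rest)                   ≡⟨ +-exchange (G fzero) _ rest ⟩
  G (fsuc fzero) + (G fzero + rest)                   ≡⟨ sum-allFins-suc² (G ∘ swapFin here) ⟨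
  sum (map (G ∘ swapFin here) (allFins _))            ∎
  where
    rest = sum (map (G ∘ fsuc ∘ fsuc) (allFins _))
    sum-allFins-suc² : (F : Fin (suc (suc n)) → ℕ) →
                       sum (map F (allFins _))
                       ≡ F fzero + (F (fsuc fzero) + sum (map (F ∘ fsuc ∘ fsuc) (allFins n)))
    sum-allFins-suc² F =
      trans (sum-allFins-suc F) (cong (F fzero +_) (sum-allFins-suc (F ∘ fsuc)))
sum-allFins-swap (there s) G =
  trans (sum-allFins-suc G)
    (trans (cong (G fzero +_) (sum-allFins-swap s (G ∘ fsuc)))
           (sym (sum-allFins-suc (G ∘ swapFin (there s)))))

sum-allBoolVecs-suc : (F : Vec Bool (suc n) → ℕ) →
                      sum (map F (allBoolVecs (suc n)))
                      ≡ sum (map (F ∘ (true ∷_)) (allBoolVecs n))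
                        + sum (map (F ∘ (false ∷_)) (allBoolVecs n))
sum-allBoolVecs-suc {n} F = begin
  sum (map F (map (true ∷_) vs ++ map (false ∷_) vs))
    ≡⟨ cong sum (map-++ F (map (true ∷_) vs) _) ⟩
  sum (map F (map (true ∷_) vs) ++ map F (map (false ∷_) vs))
    ≡⟨ sum-++ (map F (map (true ∷_) vs)) _ ⟩
  sum (map F (map (true ∷_) vs)) + sum (map F (map (false ∷_) vs))
    ≡⟨ cong₂ _+_ (sum-map-∘ F (true ∷_) vs) (sum-map-∘ F (false ∷_) vs) ⟩
  sum (map (F ∘ (true ∷_)) vs) + sum (map (F ∘ (false ∷_)) vs) ∎
  where vs = allBoolVecs n

sum-allBoolVecs-swap : (s : Swap n) (F : Vec Bool n → ℕ) →
                       sum (map F (allBoolVecs n)) ≡ sum (map (F ∘ swapVec s) (allBoolVecs n))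
sum-allBoolVecs-swap {suc (suc n)} here F = begin
  sum (map F (allBoolVecs _))                              ≡⟨ sum-allBoolVecs-suc² F ⟩
  (q F true true + q F true false) + (q F false true + q F false false)
    ≡⟨ interchange (q F true true) _ _ _ ⟩
  (q F true true + q F false true) + (q F true false + q F false false)
    ≡⟨ sum-allBoolVecs-suc² (F ∘ swapVec here) ⟨
  sum (map (F ∘ swapVec here) (allBoolVecs _))             ∎
  where
    q : (Vec Bool (suc (suc n)) → ℕ) → Bool → Bool → ℕ
    q H a b = sum (map (λ v → H (a ∷ b ∷ v)) (allBoolVecs n))
    sum-allBoolVecs-suc² : (H : Vec Bool (suc (suc n)) → ℕ) →
      sum (map H (allBoolVecs _))
      ≡ (q H true true + q H true false) + (q H false true + q H false false)
    sum-allBoolVecs-suc² H =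
      trans (sum-allBoolVecs-suc H)
            (cong₂ _+_ (sum-allBoolVecs-suc (H ∘ (true ∷_)))
                       (sum-allBoolVecs-suc (H ∘ (false ∷_))))
sum-allBoolVecs-swap (there s) F =
  trans (sum-allBoolVecs-suc F)
    (trans (cong₂ _+_ (sum-allBoolVecs-swap s (F ∘ (true ∷_)))
                      (sum-allBoolVecs-swap s (F ∘ (false ∷_))))
           (sym (sum-allBoolVecs-suc (F ∘ swapVec (there s)))))

countL-allSeqs-swap : (s : Swap n) (p : Vec (Fin n) t → Bool) →
                      countL p (allSeqs n t) ≡ countL (p ∘ Vec.map (swapFin s)) (allSeqs n t)
countL-allSeqs-swap {n} {zero}  s p = refl
countL-allSeqs-swap {n} {suc t} s p = begin
  countL p (allSeqs n (suc t))
    ≡⟨ countL-concatMap-map p _∷_ (allSeqs n t) (allFins n) ⟩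
  sum (map (λ j → countL (p ∘ (j ∷_)) (allSeqs n t)) (allFins n))
    ≡⟨ sum-allFins-swap s _ ⟩
  sum (map (λ j → countL (p ∘ (swapFin s j ∷_)) (allSeqs n t)) (allFins n))
    ≡⟨ sum-map-cong (λ j → countL-allSeqs-swap s (p ∘ (swapFin s j ∷_))) (allFins n) ⟩
  sum (map (λ j → countL (p ∘ Vec.map (swapFin s) ∘ (j ∷_)) (allSeqs n t)) (allFins n))
    ≡⟨ countL-concatMap-map (p ∘ Vec.map (swapFin s)) _∷_ (allSeqs n t) (allFins n) ⟨
  countL (p ∘ Vec.map (swapFin s)) (allSeqs n (suc t)) ∎

swapOutcome : Swap n → Vec Bool n × Vec (Fin n) t → Vec Bool n × Vec (Fin n) t
swapOutcome s = Product.map (swapVec s) (Vec.map (swapFin s))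

countL-outcomes-swap : (s : Swap n) (p : Vec Bool n × Vec (Fin n) t → Bool) →
                       countL p (outcomes n t) ≡ countL (p ∘ swapOutcome s) (outcomes n t)
countL-outcomes-swap {n} {t} s p = begin
  countL p (outcomes n t)
    ≡⟨ countL-concatMap-map p _,_ (allSeqs n t) (allBoolVecs n) ⟩
  sum (map (λ x → countL (p ∘ (x ,_)) (allSeqs n t)) (allBoolVecs n))
    ≡⟨ sum-allBoolVecs-swap s _ ⟩
  sum (map (λ x → countL (p ∘ (swapVec s x ,_)) (allSeqs n t)) (allBoolVecs n))
    ≡⟨ sum-map-cong (λ x → countL-allSeqs-swap s (p ∘ (swapVec s x ,_))) (allBoolVecs n) ⟩
  sum (map (λ x → countL (p ∘ swapOutcome s ∘ (x ,_)) (allSeqs n t)) (allBoolVecs n))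
    ≡⟨ countL-concatMap-map (p ∘ swapOutcome s) _,_ (allSeqs n t) (allBoolVecs n) ⟨
  countL (p ∘ swapOutcome s) (outcomes n t) ∎

weightTo-swap : (m0 : ℕ) (s : Swap n) (y : Vec Bool n) →
                weightTo n m0 t (swapVec s y) ≡ weightTo n m0 t y
weightTo-swap {n} {t} m0 s y =
  trans (countL-outcomes-swap s _) (countL-cong event-swap (outcomes n t))
  where
    event-swap : ((x , js) : Vec Bool n × Vec (Fin n) t) →
                 ((ones (swapVec s x) ≡ᵇ m0)
                   ∧ eqVec (sdRun (swapVec s x) (Vec.map (swapFin s) js)) (swapVec s y))
                 ≡ ((ones x ≡ᵇ m0) ∧ eqVec (sdRun x js) y)
    event-swap (x , js)
      rewrite ones-swapVec s x | sdRun-swap s x js | eqVec-swapVec s (sdRun x js) y = refl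

SwapInvariant : (Vec Bool n → A) → Set
SwapInvariant f = ∀ s x → f (swapVec s x) ≡ f x

∷-swapInvariant : (a : Bool) {f : Vec Bool (suc n) → A} →
                  SwapInvariant f → SwapInvariant (f ∘ (a ∷_))
∷-swapInvariant a inv s x = inv (there s) (a ∷ x)

onesFirst : (n k : ℕ) → Vec Bool n
onesFirst zero    k       = []
onesFirst (suc n) zero    = false ∷ onesFirst n zero
onesFirst (suc n) (suc k) = true ∷ onesFirst n k

ones≤length : (x : Vec Bool n) → ones x ≤ n
ones≤length []          = z≤n
ones≤length (true ∷ x)  = s≤s (ones≤length x)
ones≤length (false ∷ x) = m≤n⇒m≤1+n (ones≤length x)

ones-onesFirst : {k : ℕ} → k ≤ n → ones (onesFirst n k) ≡ k
ones-onesFirst {zero}  {zero}  _         = refl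
ones-onesFirst {suc n} {zero}  _         = ones-onesFirst {n} z≤n
ones-onesFirst {suc n} {suc k} (s≤s k≤n) = cong suc (ones-onesFirst k≤n)

swapInvariant-onesFirst : {f : Vec Bool n → A} → SwapInvariant f →
                          (x : Vec Bool n) → f x ≡ f (onesFirst n (ones x))
swapInvariant-onesFirst inv [] = refl
swapInvariant-onesFirst inv (true ∷ x) = swapInvariant-onesFirst (∷-swapInvariant true inv) x
swapInvariant-onesFirst inv (false ∷ x)
  with ones x | ones≤length x | swapInvariant-onesFirst (∷-swapInvariant false inv) x
... | zero  | _         | moved = moved
swapInvariant-onesFirst {suc (suc n)} {f = f} inv (false ∷ x)
    | suc k | s≤s k≤n   | moved = begin
  f (false ∷ x)
    ≡⟨ moved ⟩
  f (false ∷ true ∷ onesFirst n k)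
    ≡⟨ inv here (true ∷ false ∷ onesFirst n k) ⟩
  f (true ∷ false ∷ onesFirst n k)
    ≡⟨ swapInvariant-onesFirst (∷-swapInvariant true inv) (false ∷ onesFirst n k) ⟩
  f (true ∷ onesFirst (suc n) (ones (onesFirst n k)))
    ≡⟨ cong (λ j → f (true ∷ onesFirst (suc n) j)) (ones-onesFirst k≤n) ⟩
  f (true ∷ onesFirst (suc n) k) ∎

swapInvariant-ones : {f : Vec Bool n → A} → SwapInvariant f →
                     {x y : Vec Bool n} → ones x ≡ ones y → f x ≡ f y
swapInvariant-ones {n = n} {f = f} inv {x} {y} eq = begin
  f x                          ≡⟨ swapInvariant-onesFirst inv x ⟩
  f (onesFirst n (ones x))     ≡⟨ cong (f ∘ onesFirst n) eq ⟩
  f (onesFirst n (ones y))     ≡⟨ swapInvariant-onesFirst inv y ⟨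
  f y                          ∎

lemma7 : (n m0 t m : ℕ) → t ≤ n ∸ m0 → (y y′ : Vec Bool n) →
           ones y ≡ m → ones y′ ≡ m → weightTo n m0 t y ≡ weightTo n m0 t y′
lemma7 n m0 t m _ y y′ ones-y ones-y′ =
  swapInvariant-ones {f = weightTo n m0 t} (weightTo-swap m0) (trans ones-y (sym ones-y′))
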